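{- Let $T\subseteq\Lambda$ be a tiling containing a triple $ijk$ (with $i<j<k$). Then $T$ contains a dense triple $(\ell-1)\,\ell\,(\ell+1)$ for some $\ell$ with $i<\ell<k$.
   Context: Fix an integer $n\ge 2$, $[n]=\{1,\dots,n\}$, and let $\Lambda$ be the set of triples $ijk$ with $i<j<k$ in $[n]$. For a quadruple $i<j<k<l$, its stick is the ordered sequence $(ijk,ijl,ikl,jkl)$. A subset of $\Lambda$ is a tiling if for every quadruple $i<j<k<l$ its intersection with the stick, written as a 0/1 string along the stick order, is one of $0000,1000,1100,1110,1111,0111,0011,0001$ (these are the inversion sets of rhombus tilings of the zonogon $Z(n;2)$). A triple is dense if it is of the form $(\ell-1)\,\ell\,(\ell+1)$. -}

module Defs where

open import Data.Nat using (ℕ; suc; _≤_; _<_)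
open import Data.Bool using (Bool; true; false)
open import Data.Product using (_×_; ∃-syntax)
open import Data.Sum using (_⊎_)
open import Relation.Binary.PropositionalEquality using (_≡_)

-- A subset of Λ (triples ijk with 1 ≤ i < j < k ≤ n) is represented by its
-- characteristic function on triples of naturals; only the values on
-- triples in Λ matter.
Subset3 : Set
Subset3 = ℕ → ℕ → ℕ → Bool

InΛ : ℕ → ℕ → ℕ → ℕ → Set
InΛ n i j k = (1 ≤ i) × (i < j) × (j < k) × (k ≤ n)

data Allowed : Bool → Bool → Bool → Bool → Set where
  a0000 : Allowed false false false false
  a1000 : Allowed true  false false false
  a1100 : Allowed true  true  false false
  a1110 : Allowed true  true  true  false
  a1111 : Allowed true  true  true  true
  a0111 : Allowed false true  true  true
  a0011 : Allowed false false true  true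
  a0001 : Allowed false false false true

IsTiling : ℕ → Subset3 → Set
IsTiling n T = ∀ i j k l → 1 ≤ i → i < j → j < k → k < l → l ≤ n →
  Allowed (T i j k) (T i j l) (T i k l) (T j k l)

module Submission where

open import Defs
open import Data.Nat using (ℕ; zero; suc; _≤_; _<_; _∸_; _+_; z≤n; s≤s)
open import Data.Nat.Properties
  using (≤-refl; ≤-trans; ≤-reflexive; <⇒≤; <⇒≱; ≤-pred; n≤1+n; m≤n⇒m<n∨m≡n; +-suc; m≤m+n)
open import Data.Bool using (true)
open import Data.Empty using (⊥-elim)
open import Data.Product using (_×_; ∃-syntax; _,_)
open import Data.Sum using (_⊎_; inj₁; inj₂)
open import Relation.Binary.PropositionalEquality using (_≡_; refl; sym)

-- An admissible stick with a marked interior entry has a marked end: an induction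
-- on k − i pushes a marked triple ijk onto a strictly shorter triple inside [i, k],
-- via the stick (i, i+1, j, k) when i+1 < j and the stick (i, j, j+1, k) when j+1 < k,
-- until it is dense.

Allowed-second⇒end : ∀ {a b c d} → Allowed a b c d → b ≡ true → a ≡ true ⊎ d ≡ true
Allowed-second⇒end a1100 refl = inj₁ refl
Allowed-second⇒end a1110 refl = inj₁ refl
Allowed-second⇒end a1111 refl = inj₁ refl
Allowed-second⇒end a0111 refl = inj₂ refl

Allowed-third⇒end : ∀ {a b c d} → Allowed a b c d → c ≡ true → a ≡ true ⊎ d ≡ true
Allowed-third⇒end a1110 refl = inj₁ refl
Allowed-third⇒end a1111 refl = inj₁ refl
Allowed-third⇒end a0111 refl = inj₂ refl
Allowed-third⇒end a0011 refl = inj₂ refl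

DenseBetween : Subset3 → ℕ → ℕ → Set
DenseBetween T i k = ∃[ ℓ ] ((i < ℓ) × (ℓ < k) × (T (ℓ ∸ 1) ℓ (suc ℓ) ≡ true))

DenseBetween-mono : ∀ T {i k i′ k′} → i ≤ i′ → k′ ≤ k → DenseBetween T i′ k′ → DenseBetween T i k
DenseBetween-mono _ i≤i′ k′≤k (ℓ , i′<ℓ , ℓ<k′ , dense) =
  ℓ , ≤-trans (s≤s i≤i′) i′<ℓ , ≤-trans ℓ<k′ k′≤k , dense

width-shift : ∀ {k f i} → k ≤ suc f + i → k ≤ f + suc i
width-shift {f = f} {i} k≤ = ≤-trans k≤ (≤-reflexive (sym (+-suc f i)))

-- The fuel f bounds the width, k ≤ f + i, and drops by one at each recursive call.
tiling-dense-between : ∀ {n T} → IsTiling n T → ∀ f i j k → k ≤ f + i →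
  InΛ n i j k → T i j k ≡ true → DenseBetween T i k
tiling-dense-between tiling zero i j k k≤i (_ , i<j , j<k , _) _ =
  ⊥-elim (<⇒≱ (≤-trans i<j (<⇒≤ j<k)) k≤i)
tiling-dense-between {T = T} tiling (suc f) i j k k≤f+i (1≤i , i<j , j<k , k≤n) ijk
  with m≤n⇒m<n∨m≡n i<j | m≤n⇒m<n∨m≡n j<k
... | inj₁ i+1<j | _ with Allowed-third⇒end (tiling i (suc i) j k 1≤i ≤-refl i+1<j j<k k≤n) ijk
...   | inj₁ left  = DenseBetween-mono T ≤-refl (<⇒≤ j<k)
          (tiling-dense-between tiling f i (suc i) j (≤-pred (≤-trans j<k k≤f+i))
            (1≤i , ≤-refl , i+1<j , ≤-trans (<⇒≤ j<k) k≤n) left)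
...   | inj₂ right = DenseBetween-mono T (n≤1+n i) ≤-refl
          (tiling-dense-between tiling f (suc i) j k (width-shift k≤f+i)
            (s≤s z≤n , i+1<j , j<k , k≤n) right)
tiling-dense-between {T = T} tiling (suc f) i j k k≤f+i (1≤i , i<j , j<k , k≤n) ijk
  | inj₂ refl | inj₁ j+1<k with Allowed-second⇒end (tiling i j (suc j) k 1≤i i<j ≤-refl j+1<k k≤n) ijk
...   | inj₁ left  = suc i , ≤-refl , j<k , left
...   | inj₂ right = DenseBetween-mono T (n≤1+n i) ≤-refl
          (tiling-dense-between tiling f (suc i) (suc j) k (width-shift k≤f+i)
            (s≤s z≤n , ≤-refl , j+1<k , k≤n) right)
tiling-dense-between tiling (suc f) i j k _ _ ijk | inj₂ refl | inj₂ refl = suc i , ≤-refl , ≤-refl , ijk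

lemma4 : (n : ℕ) → 2 ≤ n → (T : Subset3) → IsTiling n T →
    (i j k : ℕ) → InΛ n i j k → T i j k ≡ true →
    ∃[ ℓ ] ((i < ℓ) × (ℓ < k) × (T (ℓ ∸ 1) ℓ (suc ℓ) ≡ true))
lemma4 n _ T tiling i j k ijk∈Λ ijk = tiling-dense-between tiling k i j k (m≤m+n k i) ijk∈Λ ijk
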